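{- Let $G$ be a connected graph of odd size. If $G$ is decomposable, then $G$ contains a locally irregular subgraph $H$ such that every connected component of $G-E(H)$ has even size.
   Context: All graphs are finite and simple. The size of a graph is its number of edges. A graph is locally irregular if any two adjacent vertices have distinct degrees. $G$ is decomposable if its edge set can be partitioned into (edge sets of) locally irregular subgraphs. -}

module Defs where

open import Data.Nat using (ℕ; zero; suc; _+_; _<ᵇ_)
open import Data.Nat.Divisibility using (_∣_)
open import Data.Bool using (Bool; true; false; _∧_; not; if_then_else_)
open import Data.Fin using (Fin; toℕ)
open import Data.List using (List; []; _∷_; map; allFin)
open import Data.Nat.ListAction using (sum)
open import Data.Product using (Σ; _×_; _,_)
open import Relation.Binary.PropositionalEquality using (_≡_; _≢_)
open import Relation.Nullary using (¬_)

count : {n : ℕ} → (Fin n → Bool) → ℕ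
count {n} p = sum (map (λ i → if p i then 1 else 0) (allFin n))

record Graph (n : ℕ) : Set where
  field
    adj    : Fin n → Fin n → Bool
    sym    : ∀ u v → adj u v ≡ adj v u
    irrefl : ∀ v → adj v v ≡ false
open Graph public

deg : {n : ℕ} → Graph n → Fin n → ℕ
deg G v = count (λ u → adj G v u)

edgesWithin : {n : ℕ} → Graph n → (Fin n → Bool) → ℕ
edgesWithin G S =
  sum (map (λ u → count (λ v → (toℕ u <ᵇ toℕ v) ∧ (S u ∧ (S v ∧ adj G u v)))) (allFin _))

size : {n : ℕ} → Graph n → ℕ
size G = edgesWithin G (λ _ → true)

Even : ℕ → Set
Even m = 2 ∣ m

Odd : ℕ → Set
Odd m = ¬ (2 ∣ m)

LocallyIrregular : {n : ℕ} → Graph n → Set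
LocallyIrregular G = ∀ u v → adj G u v ≡ true → deg G u ≢ deg G v

-- H is a subgraph of G (edge-wise; vertex sets are Fin n, isolated
-- vertices are irrelevant for sizes, degrees of edge endpoints and
-- local irregularity).
_⊆ᴳ_ : {n : ℕ} → Graph n → Graph n → Set
H ⊆ᴳ G = ∀ u v → adj H u v ≡ true → adj G u v ≡ true

data Walk {n : ℕ} (G : Graph n) : Fin n → Fin n → Set where
  here : ∀ {u} → Walk G u u
  step : ∀ {u w v} → adj G u w ≡ true → Walk G w v → Walk G u v

Connected : {n : ℕ} → Graph n → Set
Connected G = ∀ u v → Walk G u v

_∖ᴱ_ : {n : ℕ} → Graph n → Graph n → Graph n
G ∖ᴱ H = record
  { adj    = λ u v → adj G u v ∧ not (adj H u v)
  ; sym    = λ u v → cong2 (adj G u v) (adj G v u) (adj H u v) (adj H v u) (Graph.sym G u v) (Graph.sym H u v)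
  ; irrefl = λ v → irr (adj G v v) (adj H v v) (Graph.irrefl G v)
  }
  where
  cong2 : ∀ a b c d → a ≡ b → c ≡ d → (a ∧ not c) ≡ (b ∧ not d)
  cong2 a .a c .c _≡_.refl _≡_.refl = _≡_.refl
  irr : ∀ a c → a ≡ false → (a ∧ not c) ≡ false
  irr .false c _≡_.refl = _≡_.refl

IsComponent : {n : ℕ} → Graph n → (Fin n → Bool) → Set
IsComponent G S =
  Σ _ (λ v → S v ≡ true)
  × (∀ u v → S u ≡ true → adj G u v ≡ true → S v ≡ true)
  × (∀ u v → S u ≡ true → S v ≡ true → Walk G u v)

Decomposable : {n : ℕ} → Graph n → Set
Decomposable {n} G =
  Σ ℕ (λ k → Σ (Fin k → Graph n) (λ H →
      (∀ i → H i ⊆ᴳ G)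
    × (∀ i → LocallyIrregular (H i))
    × (∀ u v → adj G u v ≡ true →
         Σ (Fin k) (λ i → adj (H i) u v ≡ true
                         × (∀ j → adj (H j) u v ≡ true → j ≡ i)))))

-- Induction on the number of edges, for graphs that are connected apart from isolated
-- vertices. Take an edge u₀v₀, the piece Hᵢ of the decomposition containing it, and the
-- component K of Hᵢ through u₀; K is locally irregular since it keeps all Hᵢ-edges at its
-- vertices. If every component of E − E(K) is even, K works. Otherwise an odd component C
-- gives a smaller instance E′ = (E − E(K))[C], decomposed by the (Hⱼ − E(K))[C], which keep
-- whole Hⱼ-neighbourhoods and so stay locally irregular; let H′ be a solution for E′. In
-- E − E(H′) everything outside C is joined to u₀ through K, so a component avoiding u₀ is a
-- component of E′ − E(H′), hence even; the component of u₀ is then even because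
-- |E − E(H′)| = |E| − |H′| is even, both |E| and |H′| = |E′| − |E′ − E(H′)| being odd.

module Submission where

open import Defs hiding (sym)
open import Data.Bool using (Bool; true; false; _∧_; _∨_; not; if_then_else_) renaming (_≟_ to _≟ᴮ_)
open import Data.Bool.Properties using (¬-not; ⇔→≡; not-injective; ∧-conicalˡ; ∧-conicalʳ; ∧-zeroʳ)
open import Data.Empty using (⊥; ⊥-elim)
open import Data.Fin using (Fin; toℕ; _≟_) renaming (zero to fzero; suc to fsuc)
open import Data.Fin.Properties using (any?; all?; ¬∀⟶∃¬)
open import Data.List using (allFin; map)
open import Data.List.Properties using (map-tabulate)
open import Data.Nat using (ℕ; zero; suc; _+_; _<ᵇ_; _≤_; _<_; z≤n; s≤s; _%_)
open import Data.Nat.DivMod using (%-distribˡ-+; m%n<n)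
open import Data.Nat.Divisibility using (_∣?_; _∣0; ∣m+n∣m⇒∣n; ∣m∣n⇒∣m+n; m%n≡0⇒n∣m)
open import Data.Nat.ListAction using (sum)
open import Data.Nat.Properties
  using (+-commutativeSemigroup; +-comm; +-suc; +-mono-≤; +-mono-<-≤; +-mono-≤-<; +-monoʳ-≤;
         ≤-refl; ≤-reflexive; ≤-trans; <-≤-trans; ≤-<-trans; <-irrefl; ≤-pred; m≤m+n)
open import Algebra.Properties.CommutativeSemigroup +-commutativeSemigroup using (interchange)
open import Data.Product using (Σ; ∃-syntax; _×_; _,_)
open import Function using (_∘_; id)
open import Function.Bundles using (mk⇔)
open import Relation.Binary.PropositionalEquality using (_≡_; _≢_; refl; sym; trans; cong; cong₂; subst; module ≡-Reasoning)
open import Relation.Nullary using (yes; no; does)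
open import Relation.Nullary.Decidable using (dec-true)

private variable n : ℕ

clash : {b : Bool} → b ≡ true → b ≡ false → ⊥
clash refl ()

∧-intro : {a b : Bool} → a ≡ true → b ≡ true → a ∧ b ≡ true
∧-intro refl refl = refl

⟦_⟧ : Bool → ℕ
⟦ b ⟧ = if b then 1 else 0

∑ : (Fin n → ℕ) → ℕ
∑ f = sum (map f (allFin _))

∑-suc : (f : Fin (suc n) → ℕ) → ∑ f ≡ f fzero + ∑ (f ∘ fsuc)
∑-suc f = cong (λ xs → f fzero + sum xs) (trans (map-tabulate fsuc f) (sym (map-tabulate id (f ∘ fsuc))))

∑-cong : (f g : Fin n → ℕ) → (∀ i → f i ≡ g i) → ∑ f ≡ ∑ g
∑-cong {zero}  f g f≗g = refl
∑-cong {suc n} f g f≗g = begin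
  ∑ f                         ≡⟨ ∑-suc f ⟩
  f fzero + ∑ (f ∘ fsuc)      ≡⟨ cong₂ _+_ (f≗g fzero) (∑-cong _ _ (f≗g ∘ fsuc)) ⟩
  g fzero + ∑ (g ∘ fsuc)      ≡⟨ sym (∑-suc g) ⟩
  ∑ g                         ∎
  where open ≡-Reasoning

∑-distrib-+ : (f g : Fin n → ℕ) → ∑ (λ i → f i + g i) ≡ ∑ f + ∑ g
∑-distrib-+ {zero}  f g = refl
∑-distrib-+ {suc n} f g = begin
  ∑ (λ i → f i + g i)                                  ≡⟨ ∑-suc (λ i → f i + g i) ⟩
  (f fzero + g fzero) + ∑ (λ i → f (fsuc i) + g (fsuc i))
    ≡⟨ cong (f fzero + g fzero +_) (∑-distrib-+ (f ∘ fsuc) (g ∘ fsuc)) ⟩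
  (f fzero + g fzero) + (∑ (f ∘ fsuc) + ∑ (g ∘ fsuc))  ≡⟨ interchange (f fzero) (g fzero) _ _ ⟩
  (f fzero + ∑ (f ∘ fsuc)) + (g fzero + ∑ (g ∘ fsuc))  ≡⟨ sym (cong₂ _+_ (∑-suc f) (∑-suc g)) ⟩
  ∑ f + ∑ g                                            ∎
  where open ≡-Reasoning

∑-zero : (f : Fin n → ℕ) → (∀ i → f i ≡ 0) → ∑ f ≡ 0
∑-zero {zero}  f f≗0 = refl
∑-zero {suc n} f f≗0 = trans (∑-suc f) (cong₂ _+_ (f≗0 fzero) (∑-zero (f ∘ fsuc) (f≗0 ∘ fsuc)))

∑-mono-≤ : (f g : Fin n → ℕ) → (∀ i → f i ≤ g i) → ∑ f ≤ ∑ g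
∑-mono-≤ {zero}  f g f≤g = z≤n
∑-mono-≤ {suc n} f g f≤g rewrite ∑-suc f | ∑-suc g =
  +-mono-≤ (f≤g fzero) (∑-mono-≤ (f ∘ fsuc) (g ∘ fsuc) (f≤g ∘ fsuc))

∑-mono-< : (f g : Fin n → ℕ) → (∀ i → f i ≤ g i) → (j : Fin n) → f j < g j → ∑ f < ∑ g
∑-mono-< {suc n} f g f≤g j fj<gj rewrite ∑-suc f | ∑-suc g with j
... | fzero  = +-mono-<-≤ fj<gj (∑-mono-≤ (f ∘ fsuc) (g ∘ fsuc) (f≤g ∘ fsuc))
... | fsuc j = +-mono-≤-< (f≤g fzero) (∑-mono-< (f ∘ fsuc) (g ∘ fsuc) (f≤g ∘ fsuc) j fj<gj)

∑-const-1 : ∑ {n} (λ _ → 1) ≡ n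
∑-const-1 {zero}  = refl
∑-const-1 {suc n} = trans (∑-suc {n} (λ _ → 1)) (cong suc (∑-const-1 {n}))

⟦⟧-mono : ∀ a b → (a ≡ true → b ≡ true) → ⟦ a ⟧ ≤ ⟦ b ⟧
⟦⟧-mono true  b a⇒b rewrite a⇒b refl = ≤-refl
⟦⟧-mono false b a⇒b = z≤n

count-cong : (p q : Fin n → Bool) → (∀ i → p i ≡ q i) → count p ≡ count q
count-cong p q p≗q = ∑-cong _ _ (cong ⟦_⟧ ∘ p≗q)

count-mono-≤ : (p q : Fin n → Bool) → (∀ i → p i ≡ true → q i ≡ true) → count p ≤ count q
count-mono-≤ p q p⊆q = ∑-mono-≤ _ _ (λ i → ⟦⟧-mono (p i) (q i) (p⊆q i))

count-mono-< : (p q : Fin n → Bool) → (∀ i → p i ≡ true → q i ≡ true) →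
               (j : Fin n) → p j ≡ false → q j ≡ true → count p < count q
count-mono-< p q p⊆q j pj qj = ∑-mono-< _ _ (λ i → ⟦⟧-mono (p i) (q i) (p⊆q i)) j ⟦pj⟧<⟦qj⟧
  where
  ⟦pj⟧<⟦qj⟧ : ⟦ p j ⟧ < ⟦ q j ⟧
  ⟦pj⟧<⟦qj⟧ rewrite pj | qj = s≤s z≤n

count≤n : (p : Fin n → Bool) → count p ≤ n
count≤n {n} p =
  ≤-trans (∑-mono-≤ _ _ (λ i → ⟦⟧-mono (p i) true (λ _ → refl))) (≤-reflexive (∑-const-1 {n}))

countPairs : (Fin n → Fin n → Bool) → ℕ
countPairs r = ∑ (λ u → count (r u))

countPairs-cong : (r s : Fin n → Fin n → Bool) → (∀ u v → r u v ≡ s u v) → countPairs r ≡ countPairs s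
countPairs-cong r s r≗s = ∑-cong _ _ (λ u → count-cong (r u) (s u) (r≗s u))

countPairs-zero : (r : Fin n → Fin n → Bool) → (∀ u v → r u v ≡ false) → countPairs r ≡ 0
countPairs-zero r r≗0 = ∑-zero _ (λ u → ∑-zero _ (λ v → cong ⟦_⟧ (r≗0 u v)))

countPairs-+ : (r s t : Fin n → Fin n → Bool) → (∀ u v → ⟦ r u v ⟧ + ⟦ s u v ⟧ ≡ ⟦ t u v ⟧) →
               countPairs r + countPairs s ≡ countPairs t
countPairs-+ r s t pointwise = begin
  countPairs r + countPairs s                  ≡⟨ sym (∑-distrib-+ (count ∘ r) (count ∘ s)) ⟩
  ∑ (λ u → count (r u) + count (s u))          ≡⟨ ∑-cong _ _ (λ u → sym (∑-distrib-+ (⟦_⟧ ∘ r u) (⟦_⟧ ∘ s u))) ⟩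
  ∑ (λ u → ∑ (λ v → ⟦ r u v ⟧ + ⟦ s u v ⟧))    ≡⟨ ∑-cong _ _ (λ u → ∑-cong _ _ (pointwise u)) ⟩
  countPairs t                                 ∎
  where open ≡-Reasoning

countPairs-mono-< : (r s : Fin n → Fin n → Bool) → (∀ u v → r u v ≡ true → s u v ≡ true) →
                    (a b : Fin n) → r a b ≡ false → s a b ≡ true → countPairs r < countPairs s
countPairs-mono-< r s r⊆s a b rab sab =
  ∑-mono-< _ _ (λ u → count-mono-≤ (r u) (s u) (r⊆s u)) a (count-mono-< (r a) (s a) (r⊆s a) b rab sab)

odd⇒%2≡1 : ∀ m → Odd m → m % 2 ≡ 1
odd⇒%2≡1 m odd with m % 2 | m%n<n m 2 | m%n≡0⇒n∣m m 2
... | 0           | _                 | 2∣m = ⊥-elim (odd (2∣m refl))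
... | 1           | _                 | _   = refl
... | suc (suc _) | s≤s (s≤s ())      | _

odd+odd⇒even : ∀ m o → Odd m → Odd o → Even (m + o)
odd+odd⇒even m o odd-m odd-o = m%n≡0⇒n∣m (m + o) 2 (begin
  (m + o) % 2             ≡⟨ %-distribˡ-+ m o 2 ⟩
  (m % 2 + o % 2) % 2     ≡⟨ cong₂ (λ a b → (a + b) % 2) (odd⇒%2≡1 m odd-m) (odd⇒%2≡1 o odd-o) ⟩
  0                       ∎)
  where open ≡-Reasoning

odd[m]∧odd[m+o]⇒even[o] : ∀ m o → Odd m → Odd (m + o) → Even o
odd[m]∧odd[m+o]⇒even[o] m o odd-m odd-m+o with 2 ∣? o
... | yes 2∣o = 2∣o
... | no odd-o = ⊥-elim (odd-m+o (odd+odd⇒even m o odd-m odd-o))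

Closed : Graph n → (Fin n → Bool) → Set
Closed G S = ∀ u w → S u ≡ true → adj G u w ≡ true → S w ≡ true

closed-back : (G : Graph n) (S : Fin n → Bool) → Closed G S →
              ∀ u w → S w ≡ true → adj G u w ≡ true → S u ≡ true
closed-back G S closed u w Sw uw = closed w u Sw (trans (Graph.sym G w u) uw)

closed-not : (G : Graph n) (S : Fin n → Bool) → Closed G S → Closed G (not ∘ S)
closed-not G S closed u w ¬Su uw with S w in Sw
... | false = refl
... | true  = ⊥-elim (clash (closed-back G S closed u w Sw uw) (not-injective ¬Su))

closed-⊆ : {A B : Graph n} (S : Fin n → Bool) → A ⊆ᴳ B → Closed B S → Closed A S
closed-⊆ S A⊆B closed u w Su uw = closed u w Su (A⊆B u w uw)

⊆-trans : {A B G : Graph n} → A ⊆ᴳ B → B ⊆ᴳ G → A ⊆ᴳ G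
⊆-trans A⊆B B⊆G x y xy = B⊆G x y (A⊆B x y xy)

walk-snoc : {G : Graph n} {a b c : Fin n} → Walk G a b → adj G b c ≡ true → Walk G a c
walk-snoc here         bc = step bc here
walk-snoc (step ab wk) bc = step ab (walk-snoc wk bc)

walk-reverse : {G : Graph n} {a b : Fin n} → Walk G a b → Walk G b a
walk-reverse here = here
walk-reverse {G = G} (step {u} {w} uw wk) = walk-snoc (walk-reverse wk) (trans (Graph.sym G w u) uw)

walk-++ : {G : Graph n} {a b c : Fin n} → Walk G a b → Walk G b c → Walk G a c
walk-++ here         wk′ = wk′
walk-++ (step ab wk) wk′ = step ab (walk-++ wk wk′)

walk-⊆ : {A B : Graph n} {a b : Fin n} → A ⊆ᴳ B → Walk A a b → Walk B a b
walk-⊆ A⊆B here                 = here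
walk-⊆ A⊆B (step {u} {w} uw wk) = step (A⊆B u w uw) (walk-⊆ A⊆B wk)

walk-closed : {G : Graph n} (S : Fin n → Bool) → Closed G S →
              {a b : Fin n} → Walk G a b → S a ≡ true → S b ≡ true
walk-closed S closed here                 Sa = Sa
walk-closed S closed (step {u} {w} uw wk) Su = walk-closed S closed wk (closed u w Su uw)

infixl 30 _[_]

_[_] : Graph n → (Fin n → Bool) → Graph n
G [ S ] = record
  { adj    = λ x y → S x ∧ (S y ∧ adj G x y)
  ; sym    = symmetric
  ; irrefl = λ x → trans (cong (λ b → S x ∧ (S x ∧ b)) (Graph.irrefl G x)) (∧-zeroʳ-twice (S x))
  }
  where
  symmetric : ∀ x y → S x ∧ (S y ∧ adj G x y) ≡ S y ∧ (S x ∧ adj G y x)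
  symmetric x y rewrite Graph.sym G x y with S x | S y
  ... | true  | _     = refl
  ... | false | true  = refl
  ... | false | false = refl
  ∧-zeroʳ-twice : ∀ b → b ∧ (b ∧ false) ≡ false
  ∧-zeroʳ-twice true  = refl
  ∧-zeroʳ-twice false = refl

induced-edge : (G : Graph n) {S : Fin n → Bool} {x y : Fin n} →
               S x ≡ true → S y ≡ true → adj G x y ≡ true → adj (G [ S ]) x y ≡ true
induced-edge G Sx Sy xy = ∧-intro Sx (∧-intro Sy xy)

induced-src : (G : Graph n) (S : Fin n → Bool) {x y : Fin n} → adj (G [ S ]) x y ≡ true → S x ≡ true
induced-src G S {x} xy = ∧-conicalˡ (S x) _ xy

induced-tgt : (G : Graph n) (S : Fin n → Bool) {x y : Fin n} → adj (G [ S ]) x y ≡ true → S y ≡ true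
induced-tgt G S {x} {y} xy = ∧-conicalˡ (S y) _ (∧-conicalʳ (S x) _ xy)

induced-⊆ : (G : Graph n) (S : Fin n → Bool) → G [ S ] ⊆ᴳ G
induced-⊆ G S x y xy = ∧-conicalʳ (S y) _ (∧-conicalʳ (S x) _ xy)

induced-mono : (A B : Graph n) (S : Fin n → Bool) → A ⊆ᴳ B → A [ S ] ⊆ᴳ B [ S ]
induced-mono A B S A⊆B x y xy =
  induced-edge B (induced-src A S xy) (induced-tgt A S xy) (A⊆B x y (induced-⊆ A S x y xy))

walk-induced : {G : Graph n} (S : Fin n → Bool) → Closed G S →
               {a b : Fin n} → S a ≡ true → Walk G a b → Walk (G [ S ]) a b
walk-induced S closed Sa here = here
walk-induced {G = G} S closed Su (step {u} {w} uw wk) =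
  step (induced-edge G Su (closed u w Su uw) uw) (walk-induced S closed (closed u w Su uw) wk)

ConnectedOnEdges : Graph n → Set
ConnectedOnEdges G = ∀ a a′ b b′ → adj G a a′ ≡ true → adj G b b′ ≡ true → Walk G a b

record Component (G : Graph n) (v : Fin n) : Set where
  field
    member   : Fin n → Bool
    closed   : Closed G member
    reaches  : ∀ a → member a ≡ true → Walk G a v
    contains : member v ≡ true

module _ (G : Graph n) (v : Fin n) where

  private
    Reaches : (Fin n → Bool) → Set
    Reaches S = ∀ a → S a ≡ true → Walk G a v

    -- The fuel bound holds because every round strictly enlarges S, which has at most n members.
    grow : ∀ fuel (S : Fin n → Bool) → n ≤ fuel + count S → Reaches S → S v ≡ true → Component G v
    grow fuel S bound reaches Sv with any? (λ a → any? (λ b → S a ∧ (adj G a b ∧ not (S b)) ≟ᴮ true))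
    ... | no noLeavingEdge = record { member = S ; closed = closed ; reaches = reaches ; contains = Sv }
      where
      closed : Closed G S
      closed u w Su uw with S w in Sw
      ... | true  = refl
      ... | false = ⊥-elim (noLeavingEdge (u , w , ∧-intro Su (∧-intro uw (cong not Sw))))
    ... | yes (a , b , leaving) = enlarge fuel bound
      where
      Sa : S a ≡ true
      Sa = ∧-conicalˡ (S a) _ leaving
      ab : adj G a b ≡ true
      ab = ∧-conicalˡ (adj G a b) _ (∧-conicalʳ (S a) _ leaving)
      Sb : S b ≡ false
      Sb = not-injective (∧-conicalʳ (adj G a b) _ (∧-conicalʳ (S a) _ leaving))
      S′ : Fin n → Bool
      S′ w = S w ∨ adj G a w
      S⊆S′ : ∀ w → S w ≡ true → S′ w ≡ true
      S⊆S′ w Sw = cong (_∨ adj G a w) Sw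
      S<S′ : count S < count S′
      S<S′ = count-mono-< S S′ S⊆S′ b Sb (trans (cong (_∨ adj G a b) Sb) ab)
      reaches′ : Reaches S′
      reaches′ w S′w with S w in Sw
      ... | true  = reaches w Sw
      ... | false = step (trans (Graph.sym G w a) S′w) (reaches a Sa)
      S<n : count S < n
      S<n = <-≤-trans (count-mono-< S (λ _ → true) (λ _ _ → refl) b Sb refl) (count≤n (λ _ → true))
      enlarge : ∀ fuel → n ≤ fuel + count S → Component G v
      enlarge zero       bound = ⊥-elim (<-irrefl refl (≤-<-trans bound S<n))
      enlarge (suc fuel) bound =
        grow fuel S′ (≤-trans bound (≤-trans (≤-reflexive (sym (+-suc fuel (count S)))) (+-monoʳ-≤ fuel S<S′)))
             reaches′ (S⊆S′ v Sv)

    singleton : Fin n → Bool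
    singleton w = does (w ≟ v)

    reaches-singleton : Reaches singleton
    reaches-singleton w eq with w ≟ v
    ... | yes refl = here

  component : Component G v
  component = grow n singleton (m≤m+n n _) reaches-singleton (dec-true (v ≟ v) refl)

arcs : Graph n → ℕ
arcs G = countPairs (adj G)

edgesWithin-+ : (A B C : Graph n) (S T U : Fin n → Bool) →
                (∀ u v → ⟦ adj (A [ S ]) u v ⟧ + ⟦ adj (B [ T ]) u v ⟧ ≡ ⟦ adj (C [ U ]) u v ⟧) →
                edgesWithin A S + edgesWithin B T ≡ edgesWithin C U
edgesWithin-+ A B C S T U pointwise = countPairs-+ _ _ _ ordered
  where
  ordered : ∀ u v → ⟦ (toℕ u <ᵇ toℕ v) ∧ adj (A [ S ]) u v ⟧ + ⟦ (toℕ u <ᵇ toℕ v) ∧ adj (B [ T ]) u v ⟧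
                  ≡ ⟦ (toℕ u <ᵇ toℕ v) ∧ adj (C [ U ]) u v ⟧
  ordered u v with toℕ u <ᵇ toℕ v
  ... | false = refl
  ... | true  = pointwise u v

edgesWithin-cong : (A B : Graph n) (S : Fin n → Bool) →
                   (∀ x y → S x ≡ true → adj A x y ≡ adj B x y) → edgesWithin A S ≡ edgesWithin B S
edgesWithin-cong A B S A≗B = countPairs-cong _ _ pointwise
  where
  pointwise : ∀ x y → (toℕ x <ᵇ toℕ y) ∧ adj (A [ S ]) x y ≡ (toℕ x <ᵇ toℕ y) ∧ adj (B [ S ]) x y
  pointwise x y with S x in Sx
  ... | false = refl
  ... | true  = cong (λ b → (toℕ x <ᵇ toℕ y) ∧ (S y ∧ b)) (A≗B x y Sx)

size-∖ᴱ : (G H : Graph n) → H ⊆ᴳ G → size H + size (G ∖ᴱ H) ≡ size G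
size-∖ᴱ G H H⊆G = edgesWithin-+ H (G ∖ᴱ H) G (λ _ → true) (λ _ → true) (λ _ → true) pointwise
  where
  pointwise : ∀ u v → ⟦ adj H u v ⟧ + ⟦ adj G u v ∧ not (adj H u v) ⟧ ≡ ⟦ adj G u v ⟧
  pointwise u v with adj H u v in Huv
  ... | true  rewrite H⊆G u v Huv = refl
  ... | false with adj G u v
  ...   | true  = refl
  ...   | false = refl

edgesWithin-split : (F : Graph n) (S R : Fin n → Bool) → Closed F R → (∀ a → R a ≡ true → S a ≡ true) →
                    edgesWithin F R + edgesWithin F (λ a → S a ∧ not (R a)) ≡ edgesWithin F S
edgesWithin-split F S R closed R⊆S = edgesWithin-+ F F F R (λ a → S a ∧ not (R a)) S pointwise
  where
  pointwise : ∀ u v → ⟦ R u ∧ (R v ∧ adj F u v) ⟧ + ⟦ (S u ∧ not (R u)) ∧ ((S v ∧ not (R v)) ∧ adj F u v) ⟧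
                    ≡ ⟦ S u ∧ (S v ∧ adj F u v) ⟧
  pointwise u v with adj F u v in uv
  ... | false rewrite ∧-zeroʳ (R v) | ∧-zeroʳ (R u) | ∧-zeroʳ (S v ∧ not (R v)) | ∧-zeroʳ (S u ∧ not (R u))
                    | ∧-zeroʳ (S v) | ∧-zeroʳ (S u) = refl
  ... | true with R u in Ru
  ...   | true rewrite closed u v Ru uv | R⊆S u Ru | R⊆S v (closed u v Ru uv) = refl
  ...   | false with R v in Rv
  ...     | true  = ⊥-elim (clash (closed-back F R closed u v Rv uv) Ru)
  ...     | false with S u | S v
  ...       | false | _     = refl
  ...       | true  | false = refl
  ...       | true  | true  = refl

-- Closed sets are the unions of components, so this is stronger than evenness of every component.
EvenClosedSets : Graph n → Set
EvenClosedSets G = ∀ S → Closed G S → Even (edgesWithin G S)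

edgesWithin-zero : (G : Graph n) (S : Fin n → Bool) → (∀ u v → adj (G [ S ]) u v ≡ false) →
                   edgesWithin G S ≡ 0
edgesWithin-zero G S none = countPairs-zero _ (λ u v → trans (cong ((toℕ u <ᵇ toℕ v) ∧_) (none u v)) (∧-zeroʳ _))

-- A closed set is a disjoint union of components; peel them off one at a time.
components⇒evenClosedSets : (D : Graph n) → (∀ v → Even (edgesWithin D (Component.member (component D v)))) →
                            EvenClosedSets D
components⇒evenClosedSets {n} D evenComponent S closed = peel (suc n) S (s≤s (count≤n S)) closed
  where
  peel : ∀ fuel S → count S < fuel → Closed D S → Even (edgesWithin D S)
  peel zero       S ()    closed
  peel (suc fuel) S bound closed with any? (λ v → S v ≟ᴮ true)
  ... | no empty = subst Even (sym (edgesWithin-zero D S (λ u v → cong (_∧ (S v ∧ adj D u v)) (S≗∅ u)))) (2 ∣0)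
    where
    S≗∅ : ∀ a → S a ≡ false
    S≗∅ a with S a in Sa
    ... | true  = ⊥-elim (empty (a , Sa))
    ... | false = refl
  ... | yes (v , Sv) = subst Even (edgesWithin-split D S R R-closed R⊆S)
                              (∣m∣n⇒∣m+n (evenComponent v) (peel fuel S′ S′-bound S′-closed))
    where
    open Component (component D v) renaming (member to R; closed to R-closed)
    R⊆S : ∀ a → R a ≡ true → S a ≡ true
    R⊆S a Ra = walk-closed S closed (walk-reverse (reaches a Ra)) Sv
    S′ : Fin n → Bool
    S′ a = S a ∧ not (R a)
    S′-bound : count S′ < fuel
    S′-bound = <-≤-trans (count-mono-< S′ S (λ a → ∧-conicalˡ (S a) _) v S′v Sv) (≤-pred bound)
      where
      S′v : S′ v ≡ false
      S′v rewrite Sv | contains = refl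
    S′-closed : Closed D S′
    S′-closed u w S′u uw with R w in Rw
    ... | true  = ⊥-elim (clash (closed-back D R R-closed u w Rw uw)
                                (not-injective (∧-conicalʳ (S u) _ S′u)))
    ... | false = ∧-intro (closed u w (∧-conicalˡ (S u) _ S′u) uw) refl

-- Subgraphs keeping whole neighbourhoods

infix 4 _⊑_

record _⊑_ (H′ H : Graph n) : Set where
  field
    full : ∀ x y → adj H′ x y ≡ true → ∀ w → adj H′ x w ≡ adj H x w

open _⊑_

⊑-⊆ : {H′ H : Graph n} → H′ ⊑ H → H′ ⊆ᴳ H
⊑-⊆ H′⊑H x y xy = trans (sym (full H′⊑H x y xy y)) xy

⊑-trans : {H″ H′ H : Graph n} → H″ ⊑ H′ → H′ ⊑ H → H″ ⊑ H
full (⊑-trans H″⊑H′ H′⊑H) x y xy w = trans (full H″⊑H′ x y xy w) (full H′⊑H x y (⊑-⊆ H″⊑H′ x y xy) w)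

⊑-locallyIrregular : {H′ H : Graph n} → H′ ⊑ H → LocallyIrregular H → LocallyIrregular H′
⊑-locallyIrregular {H′ = H′} {H} H′⊑H irregular x y xy deg-x≡deg-y =
  irregular x y (⊑-⊆ H′⊑H x y xy) (begin
    deg H x   ≡⟨ sym (count-cong (adj H′ x) (adj H x) (full H′⊑H x y xy)) ⟩
    deg H′ x  ≡⟨ deg-x≡deg-y ⟩
    deg H′ y  ≡⟨ count-cong (adj H′ y) (adj H y) (full H′⊑H y x (trans (Graph.sym H′ y x) xy)) ⟩
    deg H y   ∎)
  where open ≡-Reasoning

induced-⊑ : (G H : Graph n) (C : Fin n → Bool) → H ⊆ᴳ G → Closed G C → H [ C ] ⊑ H
full (induced-⊑ G H C H⊆G closed) x y xy w rewrite induced-src H C xy with adj H x w in xw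
... | true  rewrite closed x w (induced-src H C xy) (H⊆G x w xw) = refl
... | false = ∧-zeroʳ (C w)

∖ᴱ-⊑ : (H K : Graph n) →
       (∀ x y w → adj K x w ≡ true → adj H x w ≡ true → adj H x y ≡ true → adj K x y ≡ true) →
       H ∖ᴱ K ⊑ H
full (∖ᴱ-⊑ H K allOrNothing) x y xy w with adj H x w in xw
... | false = refl
... | true with adj K x w in Kxw
...   | false = refl
...   | true  = ⊥-elim (clash Kxy (not-injective (∧-conicalʳ (adj H x y) _ xy)))
  where
  Kxy : adj K x y ≡ true
  Kxy = allOrNothing x y w Kxw xw (∧-conicalˡ (adj H x y) _ xy)

-- Passing from an odd component back to the whole graph

module _ (E K H′ : Graph n) (C : Fin n → Bool) (u₀ v₀ : Fin n)
         (connected : ConnectedOnEdges E) (u₀v₀ : adj E u₀ v₀ ≡ true)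
         (K⊆E : K ⊆ᴳ E) (K-reaches : ∀ x y → adj K x y ≡ true → Walk K x u₀)
         (C-closed : Closed (E ∖ᴱ K) C) (H′⊆E′ : H′ ⊆ᴳ (E ∖ᴱ K) [ C ]) where

  private
    D E′ F : Graph n
    D  = E ∖ᴱ K
    E′ = D [ C ]
    F  = E ∖ᴱ H′

    H′⊆E : H′ ⊆ᴳ E
    H′⊆E x y xy = ∧-conicalˡ (adj E x y) _ (induced-⊆ D C x y (H′⊆E′ x y xy))

    H′-src : ∀ {x y} → adj H′ x y ≡ true → C x ≡ true
    H′-src {x} {y} xy = induced-src D C (H′⊆E′ x y xy)

    K⊆F : K ⊆ᴳ F
    K⊆F x y Kxy = ∧-intro (K⊆E x y Kxy) (cong not (¬-not H′xy≢true))
      where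
      H′xy≢true : adj H′ x y ≢ true
      H′xy≢true H′xy = clash Kxy (not-injective (∧-conicalʳ (adj E x y) _ (induced-⊆ D C x y (H′⊆E′ x y H′xy))))

    E′∖H′⊆F : (E′ ∖ᴱ H′) ⊆ᴳ F
    E′∖H′⊆F x y xy = ∧-intro (∧-conicalˡ (adj E x y) _ (induced-⊆ D C x y (∧-conicalˡ (adj E′ x y) _ xy)))
                             (∧-conicalʳ (adj E′ x y) _ xy)

    module _ (S : Fin n → Bool) (S-closed : Closed F S) where

      K-touches-u₀ : ∀ x y → adj K x y ≡ true → S x ≡ true → S u₀ ≡ true
      K-touches-u₀ x y Kxy = walk-closed {G = F} S S-closed (walk-⊆ {A = K} K⊆F (K-reaches x y Kxy))

      -- Outside C every edge of E lies in F, except the edges of K, which are linked to u₀ inside F.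
      outside-C-touches-u₀ : ∀ {a} → C a ≡ false → S a ≡ true → Walk E a u₀ → S u₀ ≡ true
      outside-C-touches-u₀ Ca Sa here = Sa
      outside-C-touches-u₀ {a} Ca Sa (step {w = w} aw wk) with adj K a w in Kaw
      ... | true  = K-touches-u₀ a w Kaw Sa
      ... | false = outside-C-touches-u₀ Cw (S-closed a w Sa Faw) wk
        where
        Daw : adj D a w ≡ true
        Daw = ∧-intro aw (cong not Kaw)
        Cw : C w ≡ false
        Cw = ¬-not (λ Cw → clash (closed-back D C C-closed a w Cw Daw) Ca)
        Faw : adj F a w ≡ true
        Faw = ∧-intro aw (cong not (¬-not (λ H′aw → clash (H′-src H′aw) Ca)))

      module _ (Su₀ : S u₀ ≡ false) where

        F-edge⇒E′∖H′-edge : ∀ x y → S x ≡ true → adj F x y ≡ true → adj (E′ ∖ᴱ H′) x y ≡ true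
        F-edge⇒E′∖H′-edge x y Sx Fxy = ∧-intro (induced-edge D Cx (C-closed x y Cx Dxy) Dxy)
                                               (∧-conicalʳ (adj E x y) _ Fxy)
          where
          Exy : adj E x y ≡ true
          Exy = ∧-conicalˡ (adj E x y) _ Fxy
          Dxy : adj D x y ≡ true
          Dxy = ∧-intro Exy (cong not (¬-not (λ Kxy → clash (K-touches-u₀ x y Kxy Sx) Su₀)))
          Cx : C x ≡ true
          Cx = ¬-not (λ Cx → clash (outside-C-touches-u₀ Cx Sx (connected x y u₀ v₀ Exy u₀v₀)) Su₀)

        edgesWithin-avoiding-u₀ : edgesWithin F S ≡ edgesWithin (E′ ∖ᴱ H′) S
        edgesWithin-avoiding-u₀ = edgesWithin-cong F (E′ ∖ᴱ H′) S λ x y Sx →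
          ⇔→≡ (mk⇔ (F-edge⇒E′∖H′-edge x y Sx) (E′∖H′⊆F x y))

    even-avoiding-u₀ : EvenClosedSets (E′ ∖ᴱ H′) → ∀ S → Closed F S → S u₀ ≡ false → Even (edgesWithin F S)
    even-avoiding-u₀ even′ S S-closed Su₀ = subst Even (sym (edgesWithin-avoiding-u₀ S S-closed Su₀))
      (even′ S (closed-⊆ {A = E′ ∖ᴱ H′} {F} S E′∖H′⊆F S-closed))

    even-size-F : Odd (size E) → Odd (size E′) → EvenClosedSets (E′ ∖ᴱ H′) → Even (size F)
    even-size-F odd-E odd-E′ even′ =
      odd[m]∧odd[m+o]⇒even[o] (size H′) (size F) odd-H′ (subst Odd (sym (size-∖ᴱ E H′ H′⊆E)) odd-E)
      where
      odd-H′ : Odd (size H′)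
      odd-H′ even-H′ = odd-E′ (subst Even (size-∖ᴱ E′ H′ H′⊆E′)
        (∣m∣n⇒∣m+n even-H′ (even′ (λ _ → true) (λ _ _ _ _ → refl))))

  -- A closed set of F containing u₀ has a closed complement avoiding u₀, and F itself has even size.
  evenClosedSets-lift : Odd (size E) → Odd (size E′) → EvenClosedSets (E′ ∖ᴱ H′) → EvenClosedSets F
  evenClosedSets-lift odd-E odd-E′ even′ S S-closed with S u₀ in Su₀
  ... | false = even-avoiding-u₀ even′ S S-closed Su₀
  ... | true  = ∣m+n∣m⇒∣n (subst Even split (even-size-F odd-E odd-E′ even′))
                  (even-avoiding-u₀ even′ (not ∘ S) (closed-not F S S-closed) (cong not Su₀))
    where
    split : size F ≡ edgesWithin F (not ∘ S) + edgesWithin F S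
    split = trans (sym (edgesWithin-split F (λ _ → true) S S-closed (λ _ _ → refl)))
                  (+-comm (edgesWithin F S) _)

-- The descent

Solution : Graph n → Set
Solution E = Σ (Graph _) λ H → H ⊆ᴳ E × LocallyIrregular H × EvenClosedSets (E ∖ᴱ H)

module _ (E : Graph n) (connected : ConnectedOnEdges E) (odd-E : Odd (size E))
         {k : ℕ} (H : Fin k → Graph n) (H⊆E : ∀ j → H j ⊆ᴳ E) (irregular : ∀ j → LocallyIrregular (H j))
         (partition : ∀ u v → adj E u v ≡ true →
            Σ (Fin k) (λ j → adj (H j) u v ≡ true × (∀ l → adj (H l) u v ≡ true → l ≡ j)))
         (i : Fin k) (u₀ v₀ : Fin n) (Hᵢu₀v₀ : adj (H i) u₀ v₀ ≡ true) where

  private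
    open Component (component (H i) u₀) renaming (member to R; closed to R-closed; reaches to R-reaches; contains to Ru₀)

    K D : Graph n
    K = H i [ R ]
    D = E ∖ᴱ K

    K⊑Hᵢ : K ⊑ H i
    K⊑Hᵢ = induced-⊑ (H i) (H i) R (λ _ _ xy → xy) R-closed

    K⊆E : K ⊆ᴳ E
    K⊆E = ⊆-trans {A = K} {H i} {E} (induced-⊆ (H i) R) (H⊆E i)

    K-reaches : ∀ x y → adj K x y ≡ true → Walk K x u₀
    K-reaches x y xy = walk-induced R R-closed (induced-src (H i) R xy) (R-reaches x (induced-src (H i) R xy))

    u₀v₀∈K : adj K u₀ v₀ ≡ true
    u₀v₀∈K = induced-edge (H i) Ru₀ (R-closed u₀ v₀ Ru₀ Hᵢu₀v₀) Hᵢu₀v₀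

    u₀v₀∈E : adj E u₀ v₀ ≡ true
    u₀v₀∈E = K⊆E u₀ v₀ u₀v₀∈K

    Hⱼ∖K⊆D : ∀ j → (H j ∖ᴱ K) ⊆ᴳ D
    Hⱼ∖K⊆D j x y xy = ∧-intro (H⊆E j x y (∧-conicalˡ (adj (H j) x y) _ xy)) (∧-conicalʳ (adj (H j) x y) _ xy)

    -- K is a union of components of H i, and the H j are edge-disjoint.
    K-allOrNothing : ∀ j x y w → adj K x w ≡ true → adj (H j) x w ≡ true → adj (H j) x y ≡ true → adj K x y ≡ true
    K-allOrNothing j x y w Kxw Hⱼxw Hⱼxy with partition x w (H⊆E j x w Hⱼxw)
    ... | (l , _ , unique) rewrite trans (unique j Hⱼxw) (sym (unique i (⊑-⊆ K⊑Hᵢ x w Kxw))) =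
      trans (full K⊑Hᵢ x w Kxw y) Hⱼxy

    module OddComponent (v : Fin n) where
      open Component (component D v) renaming (member to C; closed to C-closed; reaches to C-reaches) public

      E′ : Graph n
      E′ = D [ C ]

      E′⊆E : E′ ⊆ᴳ E
      E′⊆E x y xy = ∧-conicalˡ (adj E x y) _ (induced-⊆ D C x y xy)

      arcs-E′<arcs-E : arcs E′ < arcs E
      arcs-E′<arcs-E = countPairs-mono-< (adj E′) (adj E) E′⊆E u₀ v₀ u₀v₀∉E′ u₀v₀∈E
        where
        u₀v₀∉E′ : adj E′ u₀ v₀ ≡ false
        u₀v₀∉E′ = ¬-not λ u₀v₀∈E′ →
          clash u₀v₀∈K (not-injective (∧-conicalʳ (adj E u₀ v₀) _ (induced-⊆ D C u₀ v₀ u₀v₀∈E′)))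

      E′-connected : ConnectedOnEdges E′
      E′-connected a a′ b b′ aa′ bb′ =
        walk-induced C C-closed (induced-src D C aa′)
          (walk-++ (C-reaches a (induced-src D C aa′)) (walk-reverse (C-reaches b (induced-src D C bb′))))

      Hᶜ : Fin k → Graph n
      Hᶜ j = (H j ∖ᴱ K) [ C ]

      Hᶜ⊑H : ∀ j → Hᶜ j ⊑ H j
      Hᶜ⊑H j = ⊑-trans (induced-⊑ D (H j ∖ᴱ K) C (Hⱼ∖K⊆D j) C-closed) (∖ᴱ-⊑ (H j) K (K-allOrNothing j))

      E′-decomposable : Decomposable E′
      E′-decomposable =
        k , Hᶜ , (λ j → induced-mono (H j ∖ᴱ K) D C (Hⱼ∖K⊆D j)) ,
        (λ j → ⊑-locallyIrregular (Hᶜ⊑H j) (irregular j)) , partition′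
        where
        partition′ : ∀ x y → adj E′ x y ≡ true →
                     Σ (Fin k) (λ j → adj (Hᶜ j) x y ≡ true × (∀ l → adj (Hᶜ l) x y ≡ true → l ≡ j))
        partition′ x y xy with partition x y (E′⊆E x y xy)
        ... | (j , Hⱼxy , unique) =
          j , induced-edge (H j ∖ᴱ K) (induced-src D C xy) (induced-tgt D C xy)
                (∧-intro Hⱼxy (∧-conicalʳ (adj E x y) _ (induced-⊆ D C x y xy))) ,
          λ l Hᶜₗxy → unique l (⊑-⊆ (Hᶜ⊑H l) x y Hᶜₗxy)

  descend : (∀ E′ → arcs E′ < arcs E → ConnectedOnEdges E′ → Odd (size E′) → Decomposable E′ → Solution E′) →
            Solution E
  descend IH with all? (λ v → 2 ∣? edgesWithin D (Component.member (component D v)))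
  ... | yes evenComponents =
    K , K⊆E , ⊑-locallyIrregular K⊑Hᵢ (irregular i) , components⇒evenClosedSets D evenComponents
  ... | no notAllEven with ¬∀⟶∃¬ n _ (λ v → 2 ∣? _) notAllEven
  ... | (v , odd-C) with IH E′ arcs-E′<arcs-E E′-connected odd-C E′-decomposable
    where open OddComponent v
  ... | (H″ , H″⊆E′ , H″-irregular , even′) =
    H″ , ⊆-trans {A = H″} {E′} {E} H″⊆E′ E′⊆E , H″-irregular ,
    evenClosedSets-lift E K H″ C u₀ v₀ connected u₀v₀∈E K⊆E K-reaches C-closed H″⊆E′ odd-E odd-C even′
    where open OddComponent v

odd⇒edge : (E : Graph n) → Odd (size E) → ∃[ u ] ∃[ v ] adj E u v ≡ true
odd⇒edge E odd-E with any? (λ u → any? (λ v → adj E u v ≟ᴮ true))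
... | yes edge  = edge
... | no noEdge = ⊥-elim (odd-E (subst Even (sym (edgesWithin-zero E (λ _ → true) edgeless)) (2 ∣0)))
  where
  edgeless : ∀ u v → adj E u v ≡ false
  edgeless u v = ¬-not (λ uv → noEdge (u , v , uv))

solution : ∀ fuel (E : Graph n) → arcs E < fuel →
           ConnectedOnEdges E → Odd (size E) → Decomposable E → Solution E
solution zero       E ()    _         _     _
solution (suc fuel) E bound connected odd-E (k , H , H⊆E , irregular , partition) with odd⇒edge E odd-E
... | (u₀ , v₀ , u₀v₀) with partition u₀ v₀ u₀v₀
... | (i , Hᵢu₀v₀ , _) = descend E connected odd-E H H⊆E irregular partition i u₀ v₀ Hᵢu₀v₀
                           (λ E′ smaller → solution fuel E′ (<-≤-trans smaller (≤-pred bound)))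

theorem7 : {n : ℕ} (G : Graph n) → Connected G → Odd (size G) → Decomposable G →
    Σ (Graph n) (λ H → H ⊆ᴳ G × LocallyIrregular H
    × ((S : Fin n → Bool) → IsComponent (G ∖ᴱ H) S → Even (edgesWithin (G ∖ᴱ H) S)))
theorem7 G connected odd-G decomposable
  with solution (suc (arcs G)) G ≤-refl (λ a _ b _ _ _ → connected a b) odd-G decomposable
... | (H , H⊆G , irregular , evenClosed) = H , H⊆G , irregular , λ S (_ , closed , _) → evenClosed S closed
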